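{- (i) There exists an infinite set $\mathcal{A} \subset \mathbb{N}_0$ whose natural density exists and equals $0$, such that $r_1(\mathcal{A}, n) \leqslant r_1(\mathcal{A}, n+1)$ holds for almost all $n \in \mathbb{N}$. (ii) There exists a set $\mathcal{A} \subset \mathbb{N}_0$ such that $\mathbb{N}_0 \setminus \mathcal{A}$ is infinite and $r_1(\mathcal{A}, n) < r_1(\mathcal{A}, n+1)$ holds for almost all $n \in \mathbb{N}$.
   Context: $\mathbb{N} = \{1,2,3,\dots\}$ and $\mathbb{N}_0 = \mathbb{N} \cup \{0\}$. For $\mathcal{A} \subset \mathbb{N}_0$ and $n \in \mathbb{N}_0$, $r_1(\mathcal{A}, n)$ denotes the number of ordered pairs $(a,b) \in \mathcal{A} \times \mathcal{A}$ with $a + b = n$. The natural density of $\mathcal{A}$ is $\lim_{N \to \infty} \mathrm{card}(\mathcal{A} \cap \{1,\dots,N\})/N$ (when it exists). A property holds for almost all $n \in \mathbb{N}$ if the set of $n \in \mathbb{N}$ for which it holds has natural density $1$. -}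

module Defs where

open import Data.Bool using (Bool; true; false; if_then_else_; _∧_)
open import Data.Nat using (ℕ; zero; suc; _≤_; _∸_)
open import Data.Integer using (+_)
open import Data.Rational using (ℚ; _/_; _-_; ∣_∣; _<_; 0ℚ)
open import Data.Product using (∃-syntax)

Subset : Set
Subset = ℕ → Bool

-- card (A ∩ {1,…,N})
count : Subset → ℕ → ℕ
count A zero    = 0
count A (suc N) = (if A (suc N) then 1 else 0) Data.Nat.+ count A N

count₀ : Subset → ℕ → ℕ
count₀ A N = (if A 0 then 1 else 0) Data.Nat.+ count A N

-- r₁(A,n) = #{(a,b) ∈ A×A : a + b = n} = #{a ∈ {0..n} : a ∈ A ∧ n - a ∈ A}
r₁ : Subset → ℕ → ℕ
r₁ A n = count₀ (λ a → A a ∧ A (n ∸ a)) n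

-- natural density of A exists and equals d :
-- card(A ∩ {1..N}) / N → d as N → ∞  (sequence indexed by N = suc M)
HasDensity : Subset → ℚ → Set
HasDensity A d =
  ∀ (ε : ℚ) → 0ℚ < ε →
    ∃[ M₀ ] (∀ M → M₀ ≤ M → ∣ ((+ count A (suc M)) / suc M) - d ∣ < ε)

AlmostAll : (ℕ → Bool) → Set
AlmostAll P = HasDensity P Data.Rational.1ℚ

Infinite : Subset → Set
Infinite A = ∀ m → ∃[ a ] (m ≤ a Data.Product.× A a ≡ true)
  where open import Relation.Binary.PropositionalEquality using (_≡_)

-- Let A be the set of positive cubes and q(N) = |A ∩ [0,N]|, so that q(N)³ ≤ N.
-- Summing r₁(A,n) over n ≤ N counts the pairs of elements of A ∩ [0,N] with sum
-- at most N, hence is at most q(N)²; and r₁(A,·) can only drop at an n with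
-- r₁(A,n) ≥ 1, so it drops at most q(N)² = o(N) times below N.
-- For the complement B of A, inclusion-exclusion gives
--   r₁(B,n) + 2 q(n) = n + 1 + r₁(A,n),
-- so r₁(B,·) strictly increases at n unless n + 1 ∈ A or r₁(A,n) ≥ 1, which
-- again happens for only O(q(N)²) values n ≤ N.

module Submission where

open import Defs
open import Data.Bool using (Bool; true; false; not; _∧_; if_then_else_)
open import Data.Bool.Properties using (not-involutive; T-≡)
open import Data.Empty using (⊥-elim)
open import Data.Nat using (ℕ; zero; suc; _+_; _*_; _∸_; _≤_; _<_; z≤n; s≤s; z<s; _≤ᵇ_; _<ᵇ_; _≟_; _≤?_)
open import Data.Nat.Properties
open import Data.Nat.Tactic.RingSolver using (solve-∀)
open import Data.Product using (_×_; ∃-syntax; _,_)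
open import Data.Sum using (inj₁; inj₂)
open import Function using (_∘_; Equivalence)
open import Relation.Nullary using (yes; no)
open import Relation.Nullary.Decidable using (isYes; toWitness; fromWitness)
open import Relation.Binary.PropositionalEquality
open import Data.Integer using (+_; -[1+_])
import Data.Integer as ℤ
import Data.Integer.Properties as ℤₚ
import Data.Integer.Tactic.RingSolver as ℤ-Solver
open import Data.Rational using (mkℚ; 0ℚ; 1ℚ; toℚᵘ; _/_; ∣_∣; _-_)
import Data.Rational as ℚ
import Data.Rational.Properties as ℚₚ
open import Data.Rational.Unnormalised using (mkℚᵘ)
import Data.Rational.Unnormalised as ℚᵘ
import Data.Rational.Unnormalised.Properties as ℚᵘₚ

-- Written with if_then_else_ so that it unfolds to the indicator used in Defs.
𝟙 : Bool → ℕ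
𝟙 b = if b then 1 else 0

𝟙≤1 : ∀ b → 𝟙 b ≤ 1
𝟙≤1 true  = ≤-refl
𝟙≤1 false = z≤n

𝟙-∧ : ∀ p q → 𝟙 (p ∧ q) ≡ 𝟙 p * 𝟙 q
𝟙-∧ true  true  = refl
𝟙-∧ true  false = refl
𝟙-∧ false q     = refl

𝟙-inclusion-exclusion : ∀ p q → 𝟙 (not p ∧ not q) + 𝟙 p + 𝟙 q ≡ 1 + 𝟙 (p ∧ q)
𝟙-inclusion-exclusion true  true  = refl
𝟙-inclusion-exclusion true  false = refl
𝟙-inclusion-exclusion false true  = refl
𝟙-inclusion-exclusion false false = refl

𝟙≡0⇒≡false : ∀ {b} → 𝟙 b ≡ 0 → b ≡ false
𝟙≡0⇒≡false {false} _ = refl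

∑< : ℕ → (ℕ → ℕ) → ℕ
∑< zero    f = 0
∑< (suc n) f = ∑< n f + f n

syntax ∑< n (λ i → e) = ∑[ i < n ] e

∑-shift : ∀ n (f : ℕ → ℕ) → ∑< (suc n) f ≡ f 0 + ∑[ i < n ] f (suc i)
∑-shift zero    f = +-comm 0 (f 0)
∑-shift (suc n) f = trans (cong (_+ f (suc n)) (∑-shift n f)) (+-assoc (f 0) _ _)

∑-cong : ∀ n {f g : ℕ → ℕ} → (∀ {i} → i < n → f i ≡ g i) → ∑< n f ≡ ∑< n g
∑-cong zero    f≡g = refl
∑-cong (suc n) f≡g = cong₂ _+_ (∑-cong n (f≡g ∘ m<n⇒m<1+n)) (f≡g ≤-refl)

∑-mono-≤ : ∀ n {f g : ℕ → ℕ} → (∀ {i} → i < n → f i ≤ g i) → ∑< n f ≤ ∑< n g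
∑-mono-≤ zero    f≤g = z≤n
∑-mono-≤ (suc n) f≤g = +-mono-≤ (∑-mono-≤ n (f≤g ∘ m<n⇒m<1+n)) (f≤g ≤-refl)

∑-monoˡ-≤ : ∀ (f : ℕ → ℕ) {m n} → m ≤ n → ∑< m f ≤ ∑< n f
∑-monoˡ-≤ f {n = zero}  z≤n = ≤-refl
∑-monoˡ-≤ f {n = suc n} m≤1+n with m≤n⇒m<n∨m≡n m≤1+n
... | inj₁ m<1+n = ≤-trans (∑-monoˡ-≤ f (≤-pred m<1+n)) (m≤m+n (∑< n f) (f n))
... | inj₂ refl  = ≤-refl

∑-distrib-+ : ∀ n (f g : ℕ → ℕ) → ∑[ i < n ] (f i + g i) ≡ ∑< n f + ∑< n g
∑-distrib-+ zero    f g = refl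
∑-distrib-+ (suc n) f g = trans (cong (_+ (f n + g n)) (∑-distrib-+ n f g)) (+-interchange (∑< n f) (∑< n g) (f n) (g n))
  where
  +-interchange : ∀ a b c d → a + b + (c + d) ≡ a + c + (b + d)
  +-interchange = solve-∀

∑-*ʳ : ∀ n (f : ℕ → ℕ) c → ∑[ i < n ] (f i * c) ≡ ∑< n f * c
∑-*ʳ zero    f c = refl
∑-*ʳ (suc n) f c = trans (cong (_+ f n * c) (∑-*ʳ n f c)) (sym (*-distribʳ-+ c (∑< n f) (f n)))

∑-const : ∀ n c → ∑[ i < n ] c ≡ n * c
∑-const zero    c = refl
∑-const (suc n) c = trans (cong (_+ c) (∑-const n c)) (+-comm (n * c) c)

∑-reverse : ∀ n (f : ℕ → ℕ) → ∑[ a < suc n ] f (n ∸ a) ≡ ∑< (suc n) f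
∑-reverse zero    f = refl
∑-reverse (suc n) f = begin
  ∑[ a < suc (suc n) ] f (suc n ∸ a)  ≡⟨ ∑-shift (suc n) (λ a → f (suc n ∸ a)) ⟩
  f (suc n) + ∑[ a < suc n ] f (n ∸ a) ≡⟨ cong (_+_ (f (suc n))) (∑-reverse n f) ⟩
  f (suc n) + ∑< (suc n) f            ≡⟨ +-comm (f (suc n)) _ ⟩
  ∑< (suc (suc n)) f                  ∎
  where open ≡-Reasoning

count< : Subset → ℕ → ℕ
count< A n = ∑[ i < n ] 𝟙 (A i)

count<-mono : ∀ A {m n} → m ≤ n → count< A m ≤ count< A n
count<-mono A = ∑-monoˡ-≤ (𝟙 ∘ A)

count-≡-∑ : ∀ A N → count A N ≡ ∑[ i < N ] 𝟙 (A (suc i))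
count-≡-∑ A zero    = refl
count-≡-∑ A (suc N) = trans (cong (_+_ (𝟙 (A (suc N)))) (count-≡-∑ A N)) (+-comm (𝟙 (A (suc N))) _)

count₀-≡-count< : ∀ A N → count₀ A N ≡ count< A (suc N)
count₀-≡-count< A N = trans (cong (_+_ (𝟙 (A 0))) (count-≡-∑ A N)) (sym (∑-shift N (𝟙 ∘ A)))

count≤count< : ∀ A N → count A N ≤ count< A (suc N)
count≤count< A N = ≤-trans (m≤n+m (count A N) (𝟙 (A 0))) (≤-reflexive (count₀-≡-count< A N))

∁ : Subset → Subset
∁ A a = not (A a)

count+count-∁ : ∀ A N → count A N + count (∁ A) N ≡ N
count+count-∁ A zero = refl
count+count-∁ A (suc N) with A (suc N)
... | true  = cong suc (count+count-∁ A N)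
... | false = trans (+-suc (count A N) _) (cong suc (count+count-∁ A N))

r₁-≡-∑ : ∀ A n → r₁ A n ≡ ∑[ a < suc n ] (𝟙 (A a) * 𝟙 (A (n ∸ a)))
r₁-≡-∑ A n = trans (count₀-≡-count< _ n) (∑-cong (suc n) λ {a} _ → 𝟙-∧ (A a) (A (n ∸ a)))

∑-r₁-≡ : ∀ A N → ∑[ n < N ] r₁ A n ≡ ∑[ a < N ] (𝟙 (A a) * count< A (N ∸ a))
∑-r₁-≡ A zero    = refl
∑-r₁-≡ A (suc N) = begin
  ∑[ n < N ] r₁ A n + r₁ A N
    ≡⟨ cong₂ _+_ (∑-r₁-≡ A N) (r₁-≡-∑ A N) ⟩
  ∑[ a < N ] (x a * count< A (N ∸ a)) + (∑[ a < N ] (x a * x (N ∸ a)) + x N * x (N ∸ N))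
    ≡⟨ sym (+-assoc (∑[ a < N ] (x a * count< A (N ∸ a))) _ _) ⟩
  ∑[ a < N ] (x a * count< A (N ∸ a)) + ∑[ a < N ] (x a * x (N ∸ a)) + x N * x (N ∸ N)
    ≡⟨ cong₂ _+_ (sym (∑-distrib-+ N _ _)) diagonal ⟩
  ∑[ a < N ] (x a * count< A (N ∸ a) + x a * x (N ∸ a)) + x N * count< A (suc N ∸ N)
    ≡⟨ cong (_+ x N * count< A (suc N ∸ N)) (∑-cong N step) ⟩
  ∑[ a < N ] (x a * count< A (suc N ∸ a)) + x N * count< A (suc N ∸ N)
    ∎
  where
  open ≡-Reasoning
  x : ℕ → ℕ
  x = 𝟙 ∘ A
  diagonal : x N * x (N ∸ N) ≡ x N * count< A (suc N ∸ N)
  diagonal rewrite n∸n≡0 N | m+n∸n≡m 1 N = refl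
  step : ∀ {a} → a < N → x a * count< A (N ∸ a) + x a * x (N ∸ a) ≡ x a * count< A (suc N ∸ a)
  step {a} a<N = begin
    x a * count< A (N ∸ a) + x a * x (N ∸ a) ≡⟨ sym (*-distribˡ-+ (x a) _ _) ⟩
    x a * count< A (suc (N ∸ a))             ≡⟨ cong (λ m → x a * count< A m) (sym (+-∸-assoc 1 (<⇒≤ a<N))) ⟩
    x a * count< A (suc N ∸ a)               ∎

∑-r₁-≤ : ∀ A N → ∑[ n < N ] r₁ A n ≤ count< A N * count< A N
∑-r₁-≤ A N = begin
  ∑[ n < N ] r₁ A n                         ≡⟨ ∑-r₁-≡ A N ⟩
  ∑[ a < N ] (𝟙 (A a) * count< A (N ∸ a)) ≤⟨ ∑-mono-≤ N (λ {a} _ → *-monoʳ-≤ (𝟙 (A a)) (count<-mono A (m∸n≤m N a))) ⟩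
  ∑[ a < N ] (𝟙 (A a) * count< A N)       ≡⟨ ∑-*ʳ N (𝟙 ∘ A) (count< A N) ⟩
  count< A N * count< A N                   ∎
  where open ≤-Reasoning

r₁-∁ : ∀ A n → r₁ (∁ A) n + (count< A (suc n) + count< A (suc n)) ≡ suc n + r₁ A n
r₁-∁ A n = begin
  r₁ (∁ A) n + (count< A (suc n) + count< A (suc n))
    ≡⟨ sym (+-assoc (r₁ (∁ A) n) _ _) ⟩
  r₁ (∁ A) n + count< A (suc n) + count< A (suc n)
    ≡⟨ cong₂ (λ u v → u + count< A (suc n) + v) (count₀-≡-count< _ n) (sym (∑-reverse n x)) ⟩
  ∑< (suc n) none + ∑< (suc n) x + ∑[ a < suc n ] x (n ∸ a)
    ≡⟨ cong (_+ ∑[ a < suc n ] x (n ∸ a)) (sym (∑-distrib-+ (suc n) none x)) ⟩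
  ∑[ a < suc n ] (none a + x a) + ∑[ a < suc n ] x (n ∸ a)
    ≡⟨ sym (∑-distrib-+ (suc n) _ _) ⟩
  ∑[ a < suc n ] (none a + x a + x (n ∸ a))
    ≡⟨ ∑-cong (suc n) (λ {a} _ → 𝟙-inclusion-exclusion (A a) (A (n ∸ a))) ⟩
  ∑[ a < suc n ] (1 + both a)
    ≡⟨ ∑-distrib-+ (suc n) (λ _ → 1) both ⟩
  ∑[ a < suc n ] 1 + ∑< (suc n) both
    ≡⟨ cong₂ _+_ (trans (∑-const (suc n) 1) (*-identityʳ (suc n))) (sym (count₀-≡-count< _ n)) ⟩
  suc n + r₁ A n
    ∎
  where
  open ≡-Reasoning
  x none both : ℕ → ℕ
  x    a = 𝟙 (A a)
  none a = 𝟙 (∁ A a ∧ ∁ A (n ∸ a))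
  both a = 𝟙 (A a ∧ A (n ∸ a))

r₁-∁-increasing : ∀ A n → A (suc n) ≡ false → r₁ A n ≡ 0 → r₁ (∁ A) n < r₁ (∁ A) (suc n)
r₁-∁-increasing A n A[1+n]≡false r₁≡0 = +-cancelʳ-< (c + c) _ _ (begin-strict
  r₁ (∁ A) n + (c + c)                ≡⟨ trans (r₁-∁ A n) (cong (_+_ (suc n)) r₁≡0) ⟩
  suc n + 0                           <⟨ s≤s (s≤s (+-monoʳ-≤ n z≤n)) ⟩
  suc (suc n) + r₁ A (suc n)          ≡⟨ sym (r₁-∁ A (suc n)) ⟩
  r₁ (∁ A) (suc n) + (c′ + c′)        ≡⟨ cong (λ k → r₁ (∁ A) (suc n) + (k + k)) c′≡c ⟩
  r₁ (∁ A) (suc n) + (c + c)          ∎)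
  where
  open ≤-Reasoning
  c c′ : ℕ
  c  = count< A (suc n)
  c′ = count< A (suc (suc n))
  c′≡c : c′ ≡ c
  c′≡c = trans (cong (λ b → c + 𝟙 b) A[1+n]≡false) (+-identityʳ c)

𝟙-not-≤ᵇ-≤ : ∀ x y → 𝟙 (not (x ≤ᵇ y)) ≤ x
𝟙-not-≤ᵇ-≤ zero    y = z≤n
𝟙-not-≤ᵇ-≤ (suc x) y = ≤-trans (𝟙≤1 _) (s≤s z≤n)

𝟙-not-<ᵇ-≤ : ∀ x y k → (k ≡ 0 → x < y) → 𝟙 (not (x <ᵇ y)) ≤ k
𝟙-not-<ᵇ-≤ x y zero    x<y = ≤-reflexive (cong (𝟙 ∘ not) (Equivalence.to T-≡ (<⇒<ᵇ (x<y refl))))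
𝟙-not-<ᵇ-≤ x y (suc k) _   = ≤-trans (𝟙≤1 _) (s≤s z≤n)

count-r₁-descents-≤ : ∀ A N →
  count (∁ (λ n → r₁ A n ≤ᵇ r₁ A (suc n))) N ≤ count< A (suc N) * count< A (suc N)
count-r₁-descents-≤ A N = begin
  count (∁ P) N                       ≤⟨ count≤count< (∁ P) N ⟩
  count< (∁ P) (suc N)                ≤⟨ ∑-mono-≤ (suc N) (λ {n} _ → 𝟙-not-≤ᵇ-≤ (r₁ A n) _) ⟩
  ∑[ n < suc N ] r₁ A n               ≤⟨ ∑-r₁-≤ A (suc N) ⟩
  count< A (suc N) * count< A (suc N) ∎
  where
  open ≤-Reasoning
  P : ℕ → Bool
  P n = r₁ A n ≤ᵇ r₁ A (suc n)

count-r₁-∁-non-increases-≤ : ∀ A N →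
  count (∁ (λ n → r₁ (∁ A) n <ᵇ r₁ (∁ A) (suc n))) N ≤ suc (count< A (suc N) + count< A (suc N) * count< A (suc N))
count-r₁-∁-non-increases-≤ A N = begin
  count (∁ P) N                                      ≤⟨ count≤count< (∁ P) N ⟩
  count< (∁ P) (suc N)                               ≤⟨ ∑-mono-≤ (suc N) (λ {n} _ → 𝟙-not-<ᵇ-≤ _ _ _ (increasing n)) ⟩
  ∑[ n < suc N ] (𝟙 (A (suc n)) + r₁ A n)            ≡⟨ ∑-distrib-+ (suc N) (𝟙 ∘ A ∘ suc) (r₁ A) ⟩
  ∑[ n < suc N ] 𝟙 (A (suc n)) + ∑[ n < suc N ] r₁ A n ≡⟨ cong (_+ ∑[ n < suc N ] r₁ A n) (sym (count-≡-∑ A (suc N))) ⟩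
  count A (suc N) + ∑[ n < suc N ] r₁ A n            ≤⟨ +-mono-≤ (+-mono-≤ (𝟙≤1 (A (suc N))) (count≤count< A N)) (∑-r₁-≤ A (suc N)) ⟩
  suc (count< A (suc N)) + count< A (suc N) * count< A (suc N) ∎
  where
  open ≤-Reasoning
  P : ℕ → Bool
  P n = r₁ (∁ A) n <ᵇ r₁ (∁ A) (suc n)
  increasing : ∀ n → 𝟙 (A (suc n)) + r₁ A n ≡ 0 → r₁ (∁ A) n < r₁ (∁ A) (suc n)
  increasing n k≡0 = r₁-∁-increasing A n (𝟙≡0⇒≡false (m+n≡0⇒m≡0 _ k≡0)) (m+n≡0⇒n≡0 (𝟙 (A (suc n))) k≡0)

Sublinear : (ℕ → ℕ) → Set
Sublinear f = ∀ k → ∃[ N₀ ] (∀ N → N₀ ≤ N → f N * suc k < N)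

sublinear-mono : ∀ {f g : ℕ → ℕ} → (∀ N → f N ≤ g N) → Sublinear g → Sublinear f
sublinear-mono f≤g g-sub k with g-sub k
... | N₀ , small = N₀ , λ N N₀≤N → ≤-<-trans (*-monoˡ-≤ (suc k) (f≤g N)) (small N N₀≤N)

cube : ℕ → ℕ
cube n = n * n * n

cube-mono : ∀ {m n} → m ≤ n → cube m ≤ cube n
cube-mono m≤n = *-mono-≤ (*-mono-≤ m≤n m≤n) m≤n

-- Q(q)(k+1) is bounded by a constant while q ≤ k + 1, and by q³ − 1 ≤ N afterwards.
cube-root-quadratic-sublinear : ∀ (q : ℕ → ℕ) → (∀ N → cube (q N) ≤ N) → Sublinear (λ N → suc (q N + q N * q N))
cube-root-quadratic-sublinear q q³≤ k = suc (Q (suc k) * suc k) , bound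
  where
  Q : ℕ → ℕ
  Q m = suc (m + m * m)
  Q-mono : ∀ {m n} → m ≤ n → Q m ≤ Q n
  Q-mono m≤n = s≤s (+-mono-≤ m≤n (*-mono-≤ m≤n m≤n))
  Q-cube : ∀ p → suc (suc p + suc p * suc p) * p + 1 ≡ suc p * suc p * suc p
  Q-cube = solve-∀
  large : ∀ m → suc k < m → Q m * suc k < cube m
  large (suc p) (s≤s k<p) = begin-strict
    Q (suc p) * suc k    ≤⟨ *-monoʳ-≤ (Q (suc p)) k<p ⟩
    Q (suc p) * p        <⟨ m<m+n _ z<s ⟩
    Q (suc p) * p + 1    ≡⟨ Q-cube p ⟩
    cube (suc p)         ∎
    where open ≤-Reasoning
  bound : ∀ N → suc (Q (suc k) * suc k) ≤ N → Q (q N) * suc k < N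
  bound N N₀≤N with q N ≤? suc k
  ... | yes q≤1+k = <-≤-trans (s≤s (*-monoˡ-≤ (suc k) (Q-mono q≤1+k))) N₀≤N
  ... | no  q≰1+k = <-≤-trans (large (q N) (≰⇒> q≰1+k)) (q³≤ N)

count<-≤-of-⊆-image : ∀ A (t : ℕ → ℕ) → (∀ {i j} → i ≤ j → t i ≤ t j) → (∀ {n} → A n ≡ true → ∃[ i ] t i ≡ n) →
                      ∀ n j → n ≤ t j → count< A n ≤ j
count<-≤-of-⊆-image A t t-mono A⊆t zero    j _    = z≤n
count<-≤-of-⊆-image A t t-mono A⊆t (suc n) j n<tj with A n in An
... | false = ≤-trans (≤-reflexive (+-identityʳ _)) (count<-≤-of-⊆-image A t t-mono A⊆t n j (<⇒≤ n<tj))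
... | true with A⊆t An
...   | i , tᵢ≡n = begin
  count< A n + 1   ≡⟨ +-comm _ 1 ⟩
  suc (count< A n) ≤⟨ s≤s (count<-≤-of-⊆-image A t t-mono A⊆t n i (≤-reflexive (sym tᵢ≡n))) ⟩
  suc i            ≤⟨ ≰⇒> (λ j≤i → <⇒≱ (subst (_< t j) (sym tᵢ≡n) n<tj) (t-mono j≤i)) ⟩
  j                ∎
  where open ≤-Reasoning

count₀-cube-≤ : ∀ A → (∀ {n} → A n ≡ true → ∃[ i ] cube (suc i) ≡ n) → ∀ N → cube (count< A (suc N)) ≤ N
count₀-cube-≤ A A⊆cubes N with count< A (suc N) in eq
... | zero  = z≤n
... | suc p = ≮⇒≥ λ N<cube → 1+n≰n (subst (_≤ p) eq
                 (count<-≤-of-⊆-image A (cube ∘ suc) (cube-mono ∘ s≤s) A⊆cubes (suc N) p N<cube))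

-- A positive ε = (n+1)/(d+1) exceeds every e/(M+1) with e (d+1) < M + 1.
ratio<positive : ∀ ε → 0ℚ ℚ.< ε → ∃[ k ] (∀ e M → e * suc k < suc M → mkℚᵘ (+ e) M ℚᵘ.< toℚᵘ ε)
ratio<positive (mkℚ (+ zero) d _)  (ℚ.*<* 0<0) = ⊥-elim (ℤₚ.<-irrefl refl 0<0)
ratio<positive (mkℚ -[1+ n ] d _)  (ℚ.*<* ())
ratio<positive (mkℚ (+ suc n) d _) _ = d , λ e M e[1+d]<1+M →
  ℚᵘ.*<* (subst₂ ℤ._<_ (ℤₚ.pos-* e (suc d)) (ℤₚ.pos-* (suc n) (suc M))
            (ℤ.+<+ (<-≤-trans e[1+d]<1+M (m≤n*m (suc M) (suc n)))))

toℚᵘ-∣/-∣ : ∀ c M d → toℚᵘ ∣ (+ c) / suc M - d ∣ ℚᵘ.≃ ℚᵘ.∣ mkℚᵘ (+ c) M ℚᵘ.- toℚᵘ d ∣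
toℚᵘ-∣/-∣ c M d = ℚᵘₚ.≃-trans (ℚₚ.toℚᵘ-homo-∣-∣ _) (ℚᵘₚ.∣-∣-cong (ℚᵘₚ.≃-trans (ℚₚ.toℚᵘ-homo-+ ((+ c) / suc M) (ℚ.- d))
                    (ℚᵘₚ.+-cong (ℚₚ.toℚᵘ-fromℚᵘ (mkℚᵘ (+ c) M)) (ℚₚ.toℚᵘ-homo‿- d))))

∣ratio-0∣ : ∀ c M → ℚᵘ.∣ mkℚᵘ (+ c) M ℚᵘ.- toℚᵘ 0ℚ ∣ ℚᵘ.≃ mkℚᵘ (+ c) M
∣ratio-0∣ c M = ℚᵘₚ.∣-∣-cong (ℚᵘₚ.+-identityʳ (mkℚᵘ (+ c) M))

ratio-1 : ∀ c e M → c + e ≡ suc M → mkℚᵘ (+ c) M ℚᵘ.- toℚᵘ 1ℚ ℚᵘ.≃ ℚᵘ.- mkℚᵘ (+ e) M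
ratio-1 c e M c+e≡1+M = ℚᵘ.*≡* (begin
  (+ c ℤ.* + 1 ℤ.+ -[1+ 0 ] ℤ.* + suc M) ℤ.* + suc M                 ≡⟨ cong (λ z → (+ c ℤ.* + 1 ℤ.+ -[1+ 0 ] ℤ.* z) ℤ.* z) 1+M≡c+e ⟩
  (+ c ℤ.* + 1 ℤ.+ -[1+ 0 ] ℤ.* (+ c ℤ.+ + e)) ℤ.* (+ c ℤ.+ + e) ≡⟨ identity (+ c) (+ e) ⟩
  ℤ.- (+ e) ℤ.* ((+ c ℤ.+ + e) ℤ.* + 1)                             ≡⟨ cong (λ z → ℤ.- (+ e) ℤ.* (z ℤ.* + 1)) (sym 1+M≡c+e) ⟩
  ℤ.- (+ e) ℤ.* + (suc M * 1)                                        ∎)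
  where
  open ≡-Reasoning
  1+M≡c+e : + suc M ≡ + c ℤ.+ + e
  1+M≡c+e = trans (cong +_ (sym c+e≡1+M)) (ℤₚ.pos-+ c e)
  identity : ∀ x y → (x ℤ.* + 1 ℤ.+ -[1+ 0 ] ℤ.* (x ℤ.+ y)) ℤ.* (x ℤ.+ y) ≡ ℤ.- y ℤ.* ((x ℤ.+ y) ℤ.* + 1)
  identity = ℤ-Solver.solve-∀

hasDensity-of-sublinear-error : ∀ A d (e : ℕ → ℕ) → Sublinear e →
  (∀ M → toℚᵘ ∣ (+ count A (suc M)) / suc M - d ∣ ℚᵘ.≃ mkℚᵘ (+ e (suc M)) M) → HasDensity A d
hasDensity-of-sublinear-error A d e e-sublinear distance ε 0<ε with ratio<positive ε 0<ε
... | k , ratio<ε with e-sublinear k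
...   | N₀ , small = N₀ , λ M N₀≤M →
  ℚₚ.toℚᵘ-cancel-< (ℚᵘₚ.<-respˡ-≃ (ℚᵘₚ.≃-sym (distance M)) (ratio<ε (e (suc M)) M (small (suc M) (m≤n⇒m≤1+n N₀≤M))))

sublinear⇒density-0 : ∀ A → Sublinear (count A) → HasDensity A 0ℚ
sublinear⇒density-0 A sublinear = hasDensity-of-sublinear-error A 0ℚ (count A) sublinear λ M →
  ℚᵘₚ.≃-trans (toℚᵘ-∣/-∣ (count A (suc M)) M 0ℚ) (∣ratio-0∣ (count A (suc M)) M)

sublinear⇒almostAll : ∀ P → Sublinear (count (∁ P)) → AlmostAll P
sublinear⇒almostAll P sublinear = hasDensity-of-sublinear-error P 1ℚ (count (∁ P)) sublinear λ M →
  ℚᵘₚ.≃-trans (toℚᵘ-∣/-∣ (count P (suc M)) M 1ℚ) (ℚᵘₚ.≃-trans (ℚᵘₚ.∣-∣-cong (ratio-1 (count P (suc M)) (count (∁ P) (suc M)) M (count+count-∁ P (suc M))))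
                                              (ℚᵘₚ.∣-p∣≃∣p∣ (mkℚᵘ (+ count (∁ P) (suc M)) M)))

module CubeSparse (A : Subset) (A⊆cubes : ∀ {n} → A n ≡ true → ∃[ i ] cube (suc i) ≡ n) where

  exceptions-sublinear : Sublinear (λ N → suc (count< A (suc N) + count< A (suc N) * count< A (suc N)))
  exceptions-sublinear = cube-root-quadratic-sublinear (count< A ∘ suc) (count₀-cube-≤ A A⊆cubes)

  density-0 : HasDensity A 0ℚ
  density-0 = sublinear⇒density-0 A (sublinear-mono
    (λ N → ≤-trans (count≤count< A N) (≤-trans (m≤m+n (count< A (suc N)) _) (n≤1+n _))) exceptions-sublinear)

  r₁-almost-monotone : AlmostAll (λ n → r₁ A n ≤ᵇ r₁ A (suc n))
  r₁-almost-monotone = sublinear⇒almostAll _ (sublinear-mono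
    (λ N → ≤-trans (count-r₁-descents-≤ A N) (≤-trans (m≤n+m _ (count< A (suc N))) (n≤1+n _))) exceptions-sublinear)

  r₁-∁-almost-increasing : AlmostAll (λ n → r₁ (∁ A) n <ᵇ r₁ (∁ A) (suc n))
  r₁-∁-almost-increasing = sublinear⇒almostAll _ (sublinear-mono (count-r₁-∁-non-increases-≤ A) exceptions-sublinear)

<cube : ∀ n → n < cube (suc n)
<cube n = ≤-trans (m≤m*n (suc n) (suc n)) (m≤m*n (suc n * suc n) (suc n))

positiveCubes : Subset
positiveCubes n = isYes (anyUpTo? (λ i → cube (suc i) ≟ n) n)

positiveCubes-⊆ : ∀ {n} → positiveCubes n ≡ true → ∃[ i ] cube (suc i) ≡ n
positiveCubes-⊆ n∈C with toWitness (Equivalence.from T-≡ n∈C)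
... | i , _ , cube≡n = i , cube≡n

positiveCubes-∋ : ∀ i → positiveCubes (cube (suc i)) ≡ true
positiveCubes-∋ i = Equivalence.to T-≡ (fromWitness (i , <cube i , refl))

positiveCubes-infinite : Infinite positiveCubes
positiveCubes-infinite m = cube (suc m) , <⇒≤ (<cube m) , positiveCubes-∋ m

theorem1p1 : (∃[ A ] (Infinite A × HasDensity A 0ℚ × AlmostAll (λ n → r₁ A n ≤ᵇ r₁ A (Data.Nat.suc n))))
    × (∃[ A ] (Infinite (λ a → not (A a)) × AlmostAll (λ n → r₁ A n <ᵇ r₁ A (Data.Nat.suc n))))
theorem1p1 =
    (positiveCubes , positiveCubes-infinite , density-0 , r₁-almost-monotone)
  , (∁ positiveCubes , ∁∁-infinite , r₁-∁-almost-increasing)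
  where
  open CubeSparse positiveCubes positiveCubes-⊆
  ∁∁-infinite : Infinite (∁ (∁ positiveCubes))
  ∁∁-infinite m with positiveCubes-infinite m
  ... | a , m≤a , a∈C = a , m≤a , trans (not-involutive _) a∈C
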